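{- Let $(P,\leq,{}',0,1)$ be a bounded distributive poset equipped with an antitone involution $'$, and let $a,b\in P$ with $a\leq b$ and $L(b,a')=\{0\}$. Then $L(a,a')=L(b,b')=\{0\}$ and $U(a,a')=U(b,b')=\{1\}$.
   Context: For a poset $(P,\leq)$ and $A\subseteq P$, $L(A)=\{x\in P\mid x\leq a \text{ for all } a\in A\}$ and $U(A)=\{x\in P\mid a\leq x\text{ for all }a\in A\}$; $L(a,b)$ means $L(\{a,b\})$, $L(A,b)$ means $L(A\cup\{b\})$, $LU(A)$ means $L(U(A))$, and similarly for $U$. A poset is distributive if $L(U(x,y),z)=LU(L(x,z),L(y,z))$ for all $x,y,z\in P$. A unary operation $'$ is antitone if $x\leq y$ implies $y'\leq x'$, and an involution if $x''=x$ for all $x$. -}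

module Defs where

open import Level using (Level; _⊔_; suc)
open import Data.Product using (_×_; _,_)
open import Data.Sum using (_⊎_)
open import Relation.Binary.Bundles using (Poset)
open import Relation.Unary using (Pred)

module PosetOps {c ℓ₁ ℓ₂ : Level} (P : Poset c ℓ₁ ℓ₂) where
  open Poset P

  Subset : Set (suc (c ⊔ ℓ₁ ⊔ ℓ₂))
  Subset = Pred Carrier (c ⊔ ℓ₁ ⊔ ℓ₂)

  L : Subset → Subset
  L A x = ∀ a → A a → x ≤ a

  U : Subset → Subset
  U A x = ∀ a → A a → a ≤ x

  pair : Carrier → Carrier → Subset
  pair a b x = Level.Lift (c ⊔ ℓ₁ ⊔ ℓ₂) ((x ≈ a) ⊎ (x ≈ b))


  _∪_ : Subset → Subset → Subset
  (A ∪ B) x = A x ⊎ B x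

  single : Carrier → Subset
  single a x = Level.Lift (c ⊔ ℓ₁ ⊔ ℓ₂) (x ≈ a)

  _∪₁_ : Subset → Carrier → Subset
  A ∪₁ b = A ∪ single b

  _≐_ : Subset → Subset → Set (c ⊔ ℓ₁ ⊔ ℓ₂)
  A ≐ B = (∀ x → A x → B x) × (∀ x → B x → A x)

  L₂ : Carrier → Carrier → Subset
  L₂ a b = L (pair a b)

  U₂ : Carrier → Carrier → Subset
  U₂ a b = U (pair a b)

  Distributive : Set (c ⊔ ℓ₁ ⊔ ℓ₂)
  Distributive = ∀ x y z →
    L (U₂ x y ∪₁ z) ≐ L (U (L₂ x z ∪ L₂ y z))

  IsLeast : Carrier → Set (c ⊔ ℓ₂)
  IsLeast o = ∀ x → o ≤ x

  IsGreatest : Carrier → Set (c ⊔ ℓ₂)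
  IsGreatest i = ∀ x → x ≤ i

  Antitone : (Carrier → Carrier) → Set (c ⊔ ℓ₂)
  Antitone f = ∀ {x y} → x ≤ y → f y ≤ f x

  Involution : (Carrier → Carrier) → Set (c ⊔ ℓ₁)
  Involution f = ∀ x → f (f x) ≈ x

-- Shrinking either argument shrinks the lower cone, so L(a,a') and L(b,b')
-- both lie in L(b,a') = {0}.  The upper cones follow by duality: the antitone
-- involution maps U(u,u') into L(u,u'), so x ∈ U(u,u') forces x' = 0 ≤ 1',
-- i.e. 1 ≤ x.
module Submission where

open import Defs
open import Level using (Level; lift; lower)
open import Data.Product using (_×_; _,_)
open import Data.Sum using (inj₁; inj₂)
open import Relation.Binary.Bundles using (Poset)
open import Relation.Unary using (_⊆′_)

module Cones {c ℓ₁ ℓ₂ : Level} (P : Poset c ℓ₁ ℓ₂) where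
  open Poset P
  open PosetOps P

  L₂-intro : ∀ {x u v} → x ≤ u → x ≤ v → L₂ u v x
  L₂-intro x≤u x≤v _ (lift (inj₁ y≈u)) = trans x≤u (reflexive (Eq.sym y≈u))
  L₂-intro x≤u x≤v _ (lift (inj₂ y≈v)) = trans x≤v (reflexive (Eq.sym y≈v))

  L₂-≤ˡ : ∀ {x u v} → L₂ u v x → x ≤ u
  L₂-≤ˡ x∈L = x∈L _ (lift (inj₁ Eq.refl))

  L₂-≤ʳ : ∀ {x u v} → L₂ u v x → x ≤ v
  L₂-≤ʳ x∈L = x∈L _ (lift (inj₂ Eq.refl))

  U₂-≤ˡ : ∀ {x u v} → U₂ u v x → u ≤ x
  U₂-≤ˡ x∈U = x∈U _ (lift (inj₁ Eq.refl))

  U₂-≤ʳ : ∀ {x u v} → U₂ u v x → v ≤ x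
  U₂-≤ʳ x∈U = x∈U _ (lift (inj₂ Eq.refl))

  L₂-mono : ∀ {u v u′ v′} → u ≤ u′ → v ≤ v′ → L₂ u v ⊆′ L₂ u′ v′
  L₂-mono u≤u′ v≤v′ _ x∈L = L₂-intro (trans (L₂-≤ˡ x∈L) u≤u′) (trans (L₂-≤ʳ x∈L) v≤v′)

  L₂≐least : ∀ {o u v} → IsLeast o → L₂ u v ⊆′ single o → L₂ u v ≐ single o
  L₂≐least least L⊆o = L⊆o , λ _ (lift x≈o) →
    L₂-intro (trans (reflexive x≈o) (least _)) (trans (reflexive x≈o) (least _))

  U₂≐greatest : ∀ {i u v} → IsGreatest i → U₂ u v ⊆′ single i → U₂ u v ≐ single i
  U₂≐greatest greatest U⊆i = U⊆i , λ _ (lift x≈i) →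
    inU (trans (greatest _) (reflexive (Eq.sym x≈i))) (trans (greatest _) (reflexive (Eq.sym x≈i)))
    where
    inU : ∀ {x u v} → u ≤ x → v ≤ x → U₂ u v x
    inU u≤x v≤x _ (lift (inj₁ y≈u)) = trans (reflexive y≈u) u≤x
    inU u≤x v≤x _ (lift (inj₂ y≈v)) = trans (reflexive y≈v) v≤x

module AntitoneInvolution {c ℓ₁ ℓ₂ : Level} (P : Poset c ℓ₁ ℓ₂)
    (_′ : Poset.Carrier P → Poset.Carrier P)
    (antitone : PosetOps.Antitone P _′) (involution : PosetOps.Involution P _′) where
  open Poset P
  open PosetOps P
  open Cones P

  ′-reflects-≤ : ∀ {x y} → x ′ ≤ y ′ → y ≤ x
  ′-reflects-≤ x′≤y′ =
    trans (reflexive (Eq.sym (involution _))) (trans (antitone x′≤y′) (reflexive (involution _)))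

  U₂-complement : ∀ {o i u} → IsLeast o → IsGreatest i →
    L₂ u (u ′) ⊆′ single o → U₂ u (u ′) ⊆′ single i
  U₂-complement {o} {i} {u} least greatest L⊆o x x∈U = lift (antisym (greatest x) i≤x)
    where
    x′∈L : L₂ u (u ′) (x ′)
    x′∈L = L₂-intro (trans (antitone (U₂-≤ʳ x∈U)) (reflexive (involution u)))
                    (antitone (U₂-≤ˡ x∈U))
    i≤x : i ≤ x
    i≤x = ′-reflects-≤ (trans (reflexive (lower (L⊆o _ x′∈L))) (least _))

mainTheorem1 : {c ℓ₁ ℓ₂ : Level} (P : Poset c ℓ₁ ℓ₂) →
    let open Poset P
        open PosetOps P
    in
    (0P 1P : Carrier) → IsLeast 0P → IsGreatest 1P →
    Distributive →
    (_′ : Carrier → Carrier) → Antitone _′ → Involution _′ →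
    (a b : Carrier) → a ≤ b → L₂ b (a ′) ≐ single 0P →
    (L₂ a (a ′) ≐ single 0P) × (L₂ b (b ′) ≐ single 0P) ×
    (U₂ a (a ′) ≐ single 1P) × (U₂ b (b ′) ≐ single 1P)
mainTheorem1 P 0P 1P least greatest _ _′ antitone involution a b a≤b (Lba′⊆0 , _) =
    L₂≐least least La⊆0 , L₂≐least least Lb⊆0 ,
    U₂≐greatest greatest (U₂-complement least greatest La⊆0) ,
    U₂≐greatest greatest (U₂-complement least greatest Lb⊆0)
  where
  open Poset P
  open PosetOps P
  open Cones P
  open AntitoneInvolution P _′ antitone involution

  La⊆0 : L₂ a (a ′) ⊆′ single 0P
  La⊆0 x x∈L = Lba′⊆0 x (L₂-mono a≤b refl x x∈L)

  Lb⊆0 : L₂ b (b ′) ⊆′ single 0P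
  Lb⊆0 x x∈L = Lba′⊆0 x (L₂-mono refl (antitone a≤b) x x∈L)
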